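{- Let $q$ be a prime power and $n,k_1,k_2,t$ positive integers with $n\geq k_1+k_2+t+3$, $k_1\geq k_2\geq t+1$, and $k_1>k_2$. Then $g_1(k_2,k_1,n,t)g_2(k_1,n,t)<g_1(k_1,k_2,n,t)g_2(k_2,n,t)$, where $g_1(k,\ell,n,t)={n-t\brack k-t}-q^{(\ell+1-t)(k-t)}{n-\ell-1\brack k-t}$ and $g_2(\ell,n,t)={n-t\brack \ell-t}+q^{\ell+1-t}{t\brack 1}$.
   Context: Gaussian binomial coefficient: ${a\brack b}=\prod_{0\leq i<b}\frac{q^{a-i}-1}{q^{b-i}-1}$ for positive integers $a,b$, with ${a\brack 0}=1$ and ${a\brack c}=0$ for negative $c$. -}

module Defs where

open import Data.Nat as ℕ using (ℕ; zero; suc; _∸_; _^_)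
open import Data.Nat.Primality using (Prime)
open import Data.Integer using (+_)
open import Data.Rational using (ℚ; 0ℚ; 1ℚ; _/_; _-_; _*_; _+_; _÷_; _≟_; ≢-nonZero)
open import Data.Product using (∃; ∃-syntax; _×_)
open import Relation.Nullary using (yes; no)
open import Relation.Binary.PropositionalEquality using (_≡_)

IsPrimePower : ℕ → Set
IsPrimePower q = ∃[ p ] ∃[ m ] (Prime p × q ≡ p ^ suc m)

⟦_⟧ : ℕ → ℚ
⟦ n ⟧ = (+ n) / 1

-- totalized division (x / 0 := 0); denominators below are nonzero when q ≥ 2
_÷'_ : ℚ → ℚ → ℚ
x ÷' y with y ≟ 0ℚ
... | yes _ = 0ℚ
... | no y≢0 = _÷_ x y {{≢-nonZero y≢0}}

prod< : ℕ → (ℕ → ℚ) → ℚ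
prod< zero f = 1ℚ
prod< (suc b) f = prod< b f * f b

gauss : ℕ → ℕ → ℕ → ℚ
gauss q a b = prod< b (λ i → (⟦ q ^ (a ∸ i) ⟧ - 1ℚ) ÷' (⟦ q ^ (b ∸ i) ⟧ - 1ℚ))

g₁ : ℕ → ℕ → ℕ → ℕ → ℕ → ℚ
g₁ q k ℓ n t = gauss q (n ∸ t) (k ∸ t)
             - ⟦ q ^ ((suc ℓ ∸ t) ℕ.* (k ∸ t)) ⟧ * gauss q (n ∸ suc ℓ) (k ∸ t)

g₂ : ℕ → ℕ → ℕ → ℕ → ℚ
g₂ q ℓ n t = gauss q (n ∸ t) (ℓ ∸ t) + ⟦ q ^ (suc ℓ ∸ t) ⟧ * gauss q t 1

{-# OPTIONS --safe #-}
-- Shift all parameters by t: k₁ = t + a, k₂ = t + b, n = t + m, and write [x]ₖ = ∏_{i<k} (q^(x-i) - 1),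
-- so that the Gaussian binomial is [x]ₖ / [k]ₖ. Multiplying both sides by [a]ₐ [b]_b (q - 1) turns the
-- claim into the inequality U (A + K) < V (B + R) between natural numbers, where U and V are the cleared
-- values of g₁(k₂,k₁,n,t) and g₁(k₁,k₂,n,t), A = [m]ₐ (q - 1), B = [m]_b (q - 1), K = q^(a+1) (q^t - 1) [a]ₐ
-- and R ≥ 0. Write a = b + 1 + d, m = a + 1 + w, and
--   Q₁ = q^((a+1)b),  F = q^(m-b) - 1,  e = q^(d+1) - 1,  X = [w]_b,  Z = [m-b-1]_d.
-- Splitting [m]ₐ and [m-b-1]ₐ at b and using q^(d+1) (q^(w+1) - 1) + e = F gives
--   A = [m]_b F Z (q - 1),   V = Z (F U + Q₁ e X).
-- Hence V B - U A ≥ [m]_b C with the cross term C = Z Q₁ e X (q - 1), and since U ≤ [m]_b it remains to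
-- see K < C. This follows from [a]ₐ = [a]_d [b+1]_b (q - 1), [a]_d ≤ Z, q^(a+1+t) ≤ Q₁ q^(gb) and
-- X ≥ q^(gb) [b+1]_b, where w = b + 1 + g with g ≥ t.
module Submission where

open import Defs
open import Data.Nat using (ℕ; _≤_; _<_; _+_)
open import Data.Rational using () renaming (_<_ to _<ℚ_; _*_ to _*ℚ_)

open import Algebra.Bundles using (CommutativeMonoid)
open import Data.Nat using (zero; suc; _*_; _∸_; _^_; z<s; NonZero; >-nonZero; nonTrivial⇒n>1)
open import Data.Nat.Coprimality using (1-coprimeTo) renaming (sym to coprime-sym)
open import Data.Nat.Primality using (prime⇒nonTrivial)
open import Data.Nat.Properties
open import Data.Nat.Tactic.RingSolver using (solve-∀)
import Data.Integer as ℤ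
import Data.Integer.Properties as ℤₚ
import Data.Integer.Tactic.RingSolver as ℤ-Solver
open import Data.Product using (_,_)
open import Data.Rational as ℚ using (ℚ; mkℚ; 0ℚ; 1ℚ; 1/_; NonNegative; ≢-nonZero)
  renaming (_+_ to _+ℚ_; _-_ to _-ℚ_)
import Data.Rational.Properties as ℚ
open import Data.Rational.Solver using (module +-*-Solver)
open import Data.Rational.Unnormalised using (*≡*)
import Data.Rational.Unnormalised.Properties as ℚᵘ
open import Relation.Binary.PropositionalEquality
open import Relation.Nullary using (yes; no; contradiction)

open import Algebra.Properties.CommutativeSemigroup (CommutativeMonoid.commutativeSemigroup ℚ.*-1-commutativeMonoid)
  using (interchange)

-- ⟦ n ⟧ normalises through a gcd that is stuck on a variable n; ⟦ n ⟧′ is its normal form.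
⟦_⟧′ : ℕ → ℚ
⟦ n ⟧′ = mkℚ (ℤ.+ n) 0 (coprime-sym (1-coprimeTo n))

⟦⟧≡⟦⟧′ : ∀ n → ⟦ n ⟧ ≡ ⟦ n ⟧′
⟦⟧≡⟦⟧′ n = ℚ.normalize-coprime _

⟦⟧-homo-+ : ∀ m n → ⟦ m + n ⟧ ≡ ⟦ m ⟧ +ℚ ⟦ n ⟧
⟦⟧-homo-+ m n rewrite ⟦⟧≡⟦⟧′ m | ⟦⟧≡⟦⟧′ n | ⟦⟧≡⟦⟧′ (m + n) =
  ℚ.toℚᵘ-injective (ℚᵘ.≃-sym (ℚᵘ.≃-trans (ℚ.toℚᵘ-homo-+ ⟦ m ⟧′ ⟦ n ⟧′)
    (*≡* (trans (regroup (ℤ.+ m) (ℤ.+ n)) (cong (ℤ._* (ℤ.1ℤ ℤ.* ℤ.1ℤ)) (sym (ℤₚ.pos-+ m n)))))))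
  where
  regroup : ∀ x y → (x ℤ.* ℤ.1ℤ ℤ.+ y ℤ.* ℤ.1ℤ) ℤ.* ℤ.1ℤ ≡ (x ℤ.+ y) ℤ.* (ℤ.1ℤ ℤ.* ℤ.1ℤ)
  regroup = ℤ-Solver.solve-∀

⟦⟧-homo-* : ∀ m n → ⟦ m * n ⟧ ≡ ⟦ m ⟧ *ℚ ⟦ n ⟧
⟦⟧-homo-* m n rewrite ⟦⟧≡⟦⟧′ m | ⟦⟧≡⟦⟧′ n | ⟦⟧≡⟦⟧′ (m * n) =
  ℚ.toℚᵘ-injective (ℚᵘ.≃-sym (ℚᵘ.≃-trans (ℚ.toℚᵘ-homo-* ⟦ m ⟧′ ⟦ n ⟧′)
    (*≡* (trans (regroup (ℤ.+ m) (ℤ.+ n)) (cong (ℤ._* (ℤ.1ℤ ℤ.* ℤ.1ℤ)) (sym (ℤₚ.pos-* m n)))))))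
  where
  regroup : ∀ x y → (x ℤ.* y) ℤ.* ℤ.1ℤ ≡ (x ℤ.* y) ℤ.* (ℤ.1ℤ ℤ.* ℤ.1ℤ)
  regroup = ℤ-Solver.solve-∀

⟦⟧-homo-∸ : ∀ {m n} → n ≤ m → ⟦ m ∸ n ⟧ ≡ ⟦ m ⟧ -ℚ ⟦ n ⟧
⟦⟧-homo-∸ {m} {n} n≤m = begin
  ⟦ m ∸ n ⟧                    ≡⟨ solve 2 (λ x y → x := x :+ y :- y) refl ⟦ m ∸ n ⟧ ⟦ n ⟧ ⟩
  ⟦ m ∸ n ⟧ +ℚ ⟦ n ⟧ -ℚ ⟦ n ⟧  ≡⟨ cong (_-ℚ ⟦ n ⟧) (⟦⟧-homo-+ (m ∸ n) n) ⟨
  ⟦ m ∸ n + n ⟧ -ℚ ⟦ n ⟧       ≡⟨ cong (λ x → ⟦ x ⟧ -ℚ ⟦ n ⟧) (m∸n+n≡m n≤m) ⟩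
  ⟦ m ⟧ -ℚ ⟦ n ⟧               ∎
  where
  open ≡-Reasoning
  open +-*-Solver using (solve; _:+_; _:-_; _:=_)

⟦⟧-mono-< : ∀ {m n} → m < n → ⟦ m ⟧ <ℚ ⟦ n ⟧
⟦⟧-mono-< {m} {n} m<n rewrite ⟦⟧≡⟦⟧′ m | ⟦⟧≡⟦⟧′ n =
  ℚ.*<* (subst₂ ℤ._<_ (sym (ℤₚ.*-identityʳ (ℤ.+ m))) (sym (ℤₚ.*-identityʳ (ℤ.+ n))) (ℤ.+<+ m<n))

⟦⟧-nonNeg : ∀ n → NonNegative ⟦ n ⟧
⟦⟧-nonNeg n rewrite ⟦⟧≡⟦⟧′ n = _

⟦⟧-≢0 : ∀ {n} → 0 < n → ⟦ n ⟧ ≢ 0ℚ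
⟦⟧-≢0 0<n ⟦n⟧≡0 = ℚ.<-irrefl (sym ⟦n⟧≡0) (⟦⟧-mono-< 0<n)

÷'-*-cancel : ∀ x {y} → y ≢ 0ℚ → (x ÷' y) *ℚ y ≡ x
÷'-*-cancel x {y} y≢0 with y ℚ.≟ 0ℚ
... | yes y≡0 = contradiction y≡0 y≢0
... | no y≢0′ = begin
  x *ℚ 1/ y *ℚ y    ≡⟨ ℚ.*-assoc x (1/ y) y ⟩
  x *ℚ (1/ y *ℚ y)  ≡⟨ cong (x *ℚ_) (ℚ.*-inverseˡ y) ⟩
  x *ℚ 1ℚ           ≡⟨ ℚ.*-identityʳ x ⟩
  x                 ∎
  where
  open ≡-Reasoning
  instance
    y-nonZero : ℚ.NonZero y
    y-nonZero = ≢-nonZero y≢0′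

u*[m*a+k]<[u*a+l]*m+r : ∀ {u m k l} a r → u ≤ m → 0 < m → k < l → u * (m * a + k) < (u * a + l) * m + r
u*[m*a+k]<[u*a+l]*m+r {u} {m} {k} {l} a r u≤m 0<m k<l = begin-strict
  u * (m * a + k)      ≡⟨ *-distribˡ-+ u (m * a) k ⟩
  u * (m * a) + u * k  ≤⟨ +-monoʳ-≤ (u * (m * a)) (*-monoˡ-≤ k u≤m) ⟩
  u * (m * a) + m * k  <⟨ +-monoʳ-< (u * (m * a)) (*-monoʳ-< m {{>-nonZero 0<m}} k<l) ⟩
  u * (m * a) + m * l  ≡⟨ regroup u m a l ⟩
  (u * a + l) * m      ≤⟨ m≤m+n _ r ⟩
  (u * a + l) * m + r  ∎
  where
  open ≤-Reasoning
  regroup : ∀ u m a l → u * (m * a) + m * l ≡ (u * a + l) * m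
  regroup = solve-∀

m≡n+o⇒m∸n≡o : ∀ {m n o} → m ≡ n + o → m ∸ n ≡ o
m≡n+o⇒m∸n≡o {n = n} {o} refl = m+n∸m≡n n o

1+[m+n]∸m≡1+n : ∀ m n → suc (m + n) ∸ m ≡ suc n
1+[m+n]∸m≡1+n m n = m≡n+o⇒m∸n≡o (sym (+-suc m n))

-- by congruence rather than rewrite: rewriting the indices of g₁ and g₂ makes Agda normalise the ℚ arithmetic
g₁-shift : ∀ q t k ℓ m →
  g₁ q (t + k) (t + ℓ) (t + m) t ≡ gauss q m k -ℚ ⟦ q ^ (suc ℓ * k) ⟧ *ℚ gauss q (m ∸ suc ℓ) k
g₁-shift q t k ℓ m = trans
  (cong₂ (λ x y → G x y (suc (t + ℓ) ∸ t) (t + m ∸ suc (t + ℓ))) (m+n∸m≡n t m) (m+n∸m≡n t k))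
  (cong₂ (G m k) (1+[m+n]∸m≡1+n t ℓ) (trans (cong (t + m ∸_) (sym (+-suc t ℓ))) ([m+n]∸[m+o]≡n∸o t m (suc ℓ))))
  where
  G : ℕ → ℕ → ℕ → ℕ → ℚ
  G x y z w = gauss q x y -ℚ ⟦ q ^ (z * y) ⟧ *ℚ gauss q w y

g₂-shift : ∀ q t ℓ m → g₂ q (t + ℓ) (t + m) t ≡ gauss q m ℓ +ℚ ⟦ q ^ suc ℓ ⟧ *ℚ gauss q t 1
g₂-shift q t ℓ m = trans
  (cong₂ (λ x y → H x y (suc (t + ℓ) ∸ t)) (m+n∸m≡n t m) (m+n∸m≡n t ℓ))
  (cong (H m ℓ) (1+[m+n]∸m≡1+n t ℓ))
  where
  H : ℕ → ℕ → ℕ → ℚ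
  H x y z = gauss q x y +ℚ ⟦ q ^ z ⟧ *ℚ gauss q t 1

module FixedBase (q : ℕ) (1<q : 1 < q) where

  instance
    q-nonZero : NonZero q
    q-nonZero = >-nonZero (<-trans z<s 1<q)

  q^∸1+1 : ∀ j → q ^ j ∸ 1 + 1 ≡ q ^ j
  q^∸1+1 j = m∸n+n≡m (m^n>0 q j)

  q^∸1-pos : ∀ {j} → 1 ≤ j → 1 ≤ q ^ j ∸ 1
  q^∸1-pos {suc j} _ = ∸-monoˡ-≤ 1 (*-mono-≤ 1<q (m^n>0 q j))

  q^∸1<q^ : ∀ j → q ^ j ∸ 1 < q ^ j
  q^∸1<q^ j = subst (q ^ j ∸ 1 <_) (q^∸1+1 j) (m<m+n (q ^ j ∸ 1) z<s)

  q^*[q^∸1]+q^∸1 : ∀ u v → q ^ v * (q ^ u ∸ 1) + (q ^ v ∸ 1) ≡ q ^ (u + v) ∸ 1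
  q^*[q^∸1]+q^∸1 u v = +-cancelʳ-≡ 1 _ _ (begin
    q ^ v * (q ^ u ∸ 1) + (q ^ v ∸ 1) + 1  ≡⟨ +-assoc (q ^ v * (q ^ u ∸ 1)) (q ^ v ∸ 1) 1 ⟩
    q ^ v * (q ^ u ∸ 1) + (q ^ v ∸ 1 + 1)  ≡⟨ cong (q ^ v * (q ^ u ∸ 1) +_) (q^∸1+1 v) ⟩
    q ^ v * (q ^ u ∸ 1) + q ^ v            ≡⟨ factor (q ^ v) (q ^ u ∸ 1) ⟩
    q ^ v * (q ^ u ∸ 1 + 1)                ≡⟨ cong (q ^ v *_) (q^∸1+1 u) ⟩
    q ^ v * q ^ u                          ≡⟨ ^-distribˡ-+-* q v u ⟨
    q ^ (v + u)                            ≡⟨ cong (q ^_) (+-comm v u) ⟩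
    q ^ (u + v)                            ≡⟨ q^∸1+1 (u + v) ⟨
    q ^ (u + v) ∸ 1 + 1                    ∎)
    where
    open ≡-Reasoning
    factor : ∀ a b → a * b + a ≡ a * (b + 1)
    factor = solve-∀

  qFalling : ℕ → ℕ → ℕ
  qFalling x zero    = 1
  qFalling x (suc k) = qFalling x k * (q ^ (x ∸ k) ∸ 1)

  qFalling-+ : ∀ x k l → qFalling x (k + l) ≡ qFalling x k * qFalling (x ∸ k) l
  qFalling-+ x k zero    = trans (cong (qFalling x) (+-identityʳ k)) (sym (*-identityʳ _))
  qFalling-+ x k (suc l) = begin
    qFalling x (k + suc l)                                     ≡⟨ cong (qFalling x) (+-suc k l) ⟩
    qFalling x (k + l) * (q ^ (x ∸ (k + l)) ∸ 1)               ≡⟨ cong₂ (λ p i → p * (q ^ i ∸ 1))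
                                                                        (qFalling-+ x k l) (sym (∸-+-assoc x k l)) ⟩
    qFalling x k * qFalling (x ∸ k) l * (q ^ (x ∸ k ∸ l) ∸ 1)  ≡⟨ *-assoc (qFalling x k) _ _ ⟩
    qFalling x k * qFalling (x ∸ k) (suc l)                    ∎
    where open ≡-Reasoning

  qFalling-suc : ∀ x k → qFalling x (suc k) ≡ (q ^ x ∸ 1) * qFalling (x ∸ 1) k
  qFalling-suc x k = trans (qFalling-+ x 1 k) (cong (_* qFalling (x ∸ 1) k) (*-identityˡ (q ^ x ∸ 1)))

  qFalling-diag-+ : ∀ k l → qFalling (k + l) (k + l) ≡ qFalling (k + l) k * qFalling l l
  qFalling-diag-+ k l = trans (qFalling-+ (k + l) k l) (cong (λ x → qFalling (k + l) k * qFalling x l) (m+n∸m≡n k l))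

  qFalling-diag-suc : ∀ k → qFalling (suc k) (suc k) ≡ qFalling (suc k) k * qFalling 1 1
  qFalling-diag-suc k = cong (qFalling (suc k) k *_) (begin
    q ^ (suc k ∸ k) ∸ 1  ≡⟨ cong (λ i → q ^ i ∸ 1) (m+n∸n≡m 1 k) ⟩
    q ^ 1 ∸ 1            ≡⟨ *-identityˡ (q ^ 1 ∸ 1) ⟨
    qFalling 1 1         ∎)
    where open ≡-Reasoning

  qFalling-pos : ∀ {x k} → k ≤ x → 1 ≤ qFalling x k
  qFalling-pos {k = zero}  _   = ≤-refl
  qFalling-pos {k = suc k} k<x = *-mono-≤ (qFalling-pos (<⇒≤ k<x)) (q^∸1-pos (m<n⇒0<n∸m k<x))

  qFalling-mono : ∀ {x y} k → x ≤ y → qFalling x k ≤ qFalling y k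
  qFalling-mono zero    x≤y = ≤-refl
  qFalling-mono (suc k) x≤y = *-mono-≤ (qFalling-mono k x≤y) (∸-monoˡ-≤ 1 (^-monoʳ-≤ q (∸-monoˡ-≤ k x≤y)))

  -- each of the k factors gains at least q^d when x grows by d
  qFalling-shift : ∀ x d k → k ≤ x → q ^ (d * k) * qFalling x k ≤ qFalling (x + d) k
  qFalling-shift x d zero    _   = ≤-reflexive (cong (λ e → q ^ e * 1) (*-zeroʳ d))
  qFalling-shift x d (suc k) k<x = begin
    q ^ (d * suc k) * (P * f)           ≡⟨ cong (λ e → q ^ e * (P * f)) (*-suc d k) ⟩
    q ^ (d + d * k) * (P * f)           ≡⟨ cong (_* (P * f)) (^-distribˡ-+-* q d (d * k)) ⟩
    q ^ d * q ^ (d * k) * (P * f)       ≡⟨ regroup (q ^ d) (q ^ (d * k)) P f ⟩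
    q ^ (d * k) * P * (q ^ d * f)       ≤⟨ *-mono-≤ (qFalling-shift x d k (<⇒≤ k<x)) (m≤m+n _ _) ⟩
    qFalling (x + d) k * (q ^ d * f + (q ^ d ∸ 1))
                                        ≡⟨ cong (qFalling (x + d) k *_) (q^*[q^∸1]+q^∸1 (x ∸ k) d) ⟩
    qFalling (x + d) k * (q ^ (x ∸ k + d) ∸ 1)
                                        ≡⟨ cong (λ i → qFalling (x + d) k * (q ^ i ∸ 1)) (+-∸-comm d (<⇒≤ k<x)) ⟨
    qFalling (x + d) k * (q ^ (x + d ∸ k) ∸ 1) ∎
    where
    open ≤-Reasoning
    P f : ℕ
    P = qFalling x k
    f = q ^ (x ∸ k) ∸ 1
    regroup : ∀ a b c e → a * b * (c * e) ≡ b * c * (a * e)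
    regroup = solve-∀

  qFalling-shift∸ : ∀ {x} d k → k + d ≤ x → q ^ (d * k) * qFalling (x ∸ d) k ≤ qFalling x k
  qFalling-shift∸ {x} d k k+d≤x =
    subst (λ y → q ^ (d * k) * qFalling (x ∸ d) k ≤ qFalling y k) (m∸n+n≡m (m+n≤o⇒n≤o k k+d≤x))
      (qFalling-shift (x ∸ d) d k (m+n≤o⇒m≤o∸n k k+d≤x))

  gauss-factor : ℕ → ℕ → ℕ → ℚ
  gauss-factor x k i = (⟦ q ^ (x ∸ i) ⟧ -ℚ 1ℚ) ÷' (⟦ q ^ (k ∸ i) ⟧ -ℚ 1ℚ)

  ⟦q^∸1⟧ : ∀ j → ⟦ q ^ j ∸ 1 ⟧ ≡ ⟦ q ^ j ⟧ -ℚ 1ℚ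
  ⟦q^∸1⟧ j = ⟦⟧-homo-∸ (m^n>0 q j)

  prod<-gauss-factor : ∀ x k j → j ≤ k → prod< j (gauss-factor x k) *ℚ ⟦ qFalling k j ⟧ ≡ ⟦ qFalling x j ⟧
  prod<-gauss-factor x k zero    _   = ℚ.*-identityˡ 1ℚ
  prod<-gauss-factor x k (suc j) j<k = begin
    A *ℚ r *ℚ ⟦ qFalling k j * (q ^ (k ∸ j) ∸ 1) ⟧       ≡⟨ cong (A *ℚ r *ℚ_) (⟦⟧-homo-* (qFalling k j) _) ⟩
    A *ℚ r *ℚ (⟦ qFalling k j ⟧ *ℚ ⟦ q ^ (k ∸ j) ∸ 1 ⟧)  ≡⟨ interchange A r ⟦ qFalling k j ⟧ _ ⟩
    A *ℚ ⟦ qFalling k j ⟧ *ℚ (r *ℚ ⟦ q ^ (k ∸ j) ∸ 1 ⟧)  ≡⟨ cong₂ _*ℚ_ (prod<-gauss-factor x k j (<⇒≤ j<k)) r*denominator ⟩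
    ⟦ qFalling x j ⟧ *ℚ ⟦ q ^ (x ∸ j) ∸ 1 ⟧              ≡⟨ ⟦⟧-homo-* (qFalling x j) _ ⟨
    ⟦ qFalling x (suc j) ⟧                                ∎
    where
    open ≡-Reasoning
    A r : ℚ
    A = prod< j (gauss-factor x k)
    r = gauss-factor x k j
    denominator≢0 : ⟦ q ^ (k ∸ j) ⟧ -ℚ 1ℚ ≢ 0ℚ
    denominator≢0 = subst (_≢ 0ℚ) (⟦q^∸1⟧ (k ∸ j)) (⟦⟧-≢0 (q^∸1-pos (m<n⇒0<n∸m j<k)))
    r*denominator : r *ℚ ⟦ q ^ (k ∸ j) ∸ 1 ⟧ ≡ ⟦ q ^ (x ∸ j) ∸ 1 ⟧
    r*denominator = begin
      r *ℚ ⟦ q ^ (k ∸ j) ∸ 1 ⟧       ≡⟨ cong (r *ℚ_) (⟦q^∸1⟧ (k ∸ j)) ⟩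
      r *ℚ (⟦ q ^ (k ∸ j) ⟧ -ℚ 1ℚ)  ≡⟨ ÷'-*-cancel _ denominator≢0 ⟩
      ⟦ q ^ (x ∸ j) ⟧ -ℚ 1ℚ         ≡⟨ ⟦q^∸1⟧ (x ∸ j) ⟨
      ⟦ q ^ (x ∸ j) ∸ 1 ⟧            ∎

  gauss-*-qFalling : ∀ x k → gauss q x k *ℚ ⟦ qFalling k k ⟧ ≡ ⟦ qFalling x k ⟧
  gauss-*-qFalling x k = prod<-gauss-factor x k k ≤-refl

  -- g₁ and g₂ in the variables shifted by t, times the denominators of their Gaussian binomials
  g₁-cleared : ℕ → ℕ → ℕ → ℕ
  g₁-cleared k ℓ m = qFalling m k ∸ q ^ (suc ℓ * k) * qFalling (m ∸ suc ℓ) k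

  g₂-cleared : ℕ → ℕ → ℕ → ℕ
  g₂-cleared ℓ m t = qFalling m ℓ * qFalling 1 1 + q ^ suc ℓ * qFalling t 1 * qFalling ℓ ℓ

  g₁-clear : ∀ k ℓ m → k + suc ℓ ≤ m →
    (gauss q m k -ℚ ⟦ q ^ (suc ℓ * k) ⟧ *ℚ gauss q (m ∸ suc ℓ) k) *ℚ ⟦ qFalling k k ⟧ ≡ ⟦ g₁-cleared k ℓ m ⟧
  g₁-clear k ℓ m k+ℓ<m = begin
    (G -ℚ Q *ℚ G′) *ℚ D                                     ≡⟨ distrib G Q G′ D ⟩
    G *ℚ D -ℚ Q *ℚ (G′ *ℚ D)                                ≡⟨ cong₂ (λ u v → u -ℚ Q *ℚ v)
                                                                 (gauss-*-qFalling m k) (gauss-*-qFalling (m ∸ suc ℓ) k) ⟩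
    ⟦ qFalling m k ⟧ -ℚ Q *ℚ ⟦ qFalling (m ∸ suc ℓ) k ⟧      ≡⟨ cong (⟦ qFalling m k ⟧ -ℚ_) (⟦⟧-homo-* (q ^ (suc ℓ * k)) _) ⟨
    ⟦ qFalling m k ⟧ -ℚ ⟦ q ^ (suc ℓ * k) * qFalling (m ∸ suc ℓ) k ⟧
                                                            ≡⟨ ⟦⟧-homo-∸ (qFalling-shift∸ (suc ℓ) k k+ℓ<m) ⟨
    ⟦ g₁-cleared k ℓ m ⟧                                     ∎
    where
    open ≡-Reasoning
    open +-*-Solver using (solve; _:-_; _:*_; _:=_)
    G G′ Q D : ℚ
    G  = gauss q m k
    G′ = gauss q (m ∸ suc ℓ) k
    Q  = ⟦ q ^ (suc ℓ * k) ⟧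
    D  = ⟦ qFalling k k ⟧
    distrib : ∀ g h g′ d → (g -ℚ h *ℚ g′) *ℚ d ≡ g *ℚ d -ℚ h *ℚ (g′ *ℚ d)
    distrib = solve 4 (λ g h g′ d → (g :- h :* g′) :* d := g :* d :- h :* (g′ :* d)) refl

  g₂-clear : ∀ ℓ m t →
    (gauss q m ℓ +ℚ ⟦ q ^ suc ℓ ⟧ *ℚ gauss q t 1) *ℚ ⟦ qFalling ℓ ℓ * qFalling 1 1 ⟧ ≡ ⟦ g₂-cleared ℓ m t ⟧
  g₂-clear ℓ m t = begin
    (G +ℚ Q *ℚ C) *ℚ ⟦ qFalling ℓ ℓ * qFalling 1 1 ⟧      ≡⟨ cong ((G +ℚ Q *ℚ C) *ℚ_) (⟦⟧-homo-* (qFalling ℓ ℓ) _) ⟩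
    (G +ℚ Q *ℚ C) *ℚ (D *ℚ F)                            ≡⟨ distrib G Q C D F ⟩
    G *ℚ D *ℚ F +ℚ Q *ℚ (C *ℚ F) *ℚ D                   ≡⟨ cong₂ (λ u v → u *ℚ F +ℚ Q *ℚ v *ℚ D)
                                                             (gauss-*-qFalling m ℓ) (gauss-*-qFalling t 1) ⟩
    ⟦ qFalling m ℓ ⟧ *ℚ F +ℚ Q *ℚ ⟦ qFalling t 1 ⟧ *ℚ D  ≡⟨ ⟦g₂-cleared⟧ ⟨
    ⟦ g₂-cleared ℓ m t ⟧                                  ∎
    where
    open ≡-Reasoning
    open +-*-Solver using (solve; _:+_; _:*_; _:=_)
    G Q C D F : ℚ
    G = gauss q m ℓ
    Q = ⟦ q ^ suc ℓ ⟧
    C = gauss q t 1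
    D = ⟦ qFalling ℓ ℓ ⟧
    F = ⟦ qFalling 1 1 ⟧
    distrib : ∀ g h c d f → (g +ℚ h *ℚ c) *ℚ (d *ℚ f) ≡ g *ℚ d *ℚ f +ℚ h *ℚ (c *ℚ f) *ℚ d
    distrib = solve 5 (λ g h c d f → (g :+ h :* c) :* (d :* f) := g :* d :* f :+ h :* (c :* f) :* d) refl
    ⟦g₂-cleared⟧ : ⟦ g₂-cleared ℓ m t ⟧ ≡ ⟦ qFalling m ℓ ⟧ *ℚ F +ℚ Q *ℚ ⟦ qFalling t 1 ⟧ *ℚ D
    ⟦g₂-cleared⟧ = trans (⟦⟧-homo-+ (qFalling m ℓ * qFalling 1 1) (q ^ suc ℓ * qFalling t 1 * qFalling ℓ ℓ))
      (cong₂ _+ℚ_ (⟦⟧-homo-* (qFalling m ℓ) (qFalling 1 1))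
        (trans (⟦⟧-homo-* (q ^ suc ℓ * qFalling t 1) (qFalling ℓ ℓ)) (cong (_*ℚ D) (⟦⟧-homo-* (q ^ suc ℓ) (qFalling t 1)))))

  g₁g₂-clear : ∀ t k ℓ m → k + suc ℓ ≤ m →
    g₁ q (t + k) (t + ℓ) (t + m) t *ℚ g₂ q (t + ℓ) (t + m) t *ℚ ⟦ qFalling k k * (qFalling ℓ ℓ * qFalling 1 1) ⟧
      ≡ ⟦ g₁-cleared k ℓ m * g₂-cleared ℓ m t ⟧
  g₁g₂-clear t k ℓ m k+ℓ<m = begin
    g₁ q (t + k) (t + ℓ) (t + m) t *ℚ g₂ q (t + ℓ) (t + m) t *ℚ ⟦ qFalling k k * Dℓ ⟧
      ≡⟨ cong₂ _*ℚ_ (cong₂ _*ℚ_ (g₁-shift q t k ℓ m) (g₂-shift q t ℓ m)) (⟦⟧-homo-* (qFalling k k) Dℓ) ⟩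
    G₁ *ℚ G₂ *ℚ (⟦ qFalling k k ⟧ *ℚ ⟦ Dℓ ⟧)
      ≡⟨ interchange G₁ G₂ ⟦ qFalling k k ⟧ ⟦ Dℓ ⟧ ⟩
    G₁ *ℚ ⟦ qFalling k k ⟧ *ℚ (G₂ *ℚ ⟦ Dℓ ⟧)
      ≡⟨ cong₂ _*ℚ_ (g₁-clear k ℓ m k+ℓ<m) (g₂-clear ℓ m t) ⟩
    ⟦ g₁-cleared k ℓ m ⟧ *ℚ ⟦ g₂-cleared ℓ m t ⟧
      ≡⟨ ⟦⟧-homo-* (g₁-cleared k ℓ m) (g₂-cleared ℓ m t) ⟨
    ⟦ g₁-cleared k ℓ m * g₂-cleared ℓ m t ⟧ ∎
    where
    open ≡-Reasoning
    Dℓ : ℕ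
    Dℓ = qFalling ℓ ℓ * qFalling 1 1
    G₁ G₂ : ℚ
    G₁ = gauss q m k -ℚ ⟦ q ^ (suc ℓ * k) ⟧ *ℚ gauss q (m ∸ suc ℓ) k
    G₂ = gauss q m ℓ +ℚ ⟦ q ^ suc ℓ ⟧ *ℚ gauss q t 1

  cleared-<⇒< : ∀ t a b m → b + suc a ≤ m → a + suc b ≤ m →
    g₁-cleared b a m * g₂-cleared a m t < g₁-cleared a b m * g₂-cleared b m t →
    g₁ q (t + b) (t + a) (t + m) t *ℚ g₂ q (t + a) (t + m) t <ℚ g₁ q (t + a) (t + b) (t + m) t *ℚ g₂ q (t + b) (t + m) t
  cleared-<⇒< t a b m b+a<m a+b<m cleared-< = ℚ.*-cancelʳ-<-nonNeg ⟦ D ⟧ {{⟦⟧-nonNeg D}}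
    (subst₂ _<ℚ_ (sym (g₁g₂-clear t b a m b+a<m))
      (sym (trans (cong (λ n → g₁ q (t + a) (t + b) (t + m) t *ℚ g₂ q (t + b) (t + m) t *ℚ ⟦ n ⟧)
                        (swap (qFalling b b) (qFalling a a) (qFalling 1 1)))
                  (g₁g₂-clear t a b m a+b<m)))
      (⟦⟧-mono-< cleared-<))
    where
    D : ℕ
    D = qFalling b b * (qFalling a a * qFalling 1 1)
    swap : ∀ x y z → x * (y * z) ≡ y * (x * z)
    swap = solve-∀

  -- k₂ = t + b, k₁ = t + a, n = t + m; the names follow the proof idea at the top
  module _ (b d g : ℕ) where
    private
      a w m : ℕ
      a = b + suc d
      w = suc b + g
      m = suc a + w
      Q₁ Q₂ F e X Y Z U : ℕ
      Q₁ = q ^ (suc a * b)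
      Q₂ = q ^ (suc b * a)
      F = q ^ (m ∸ b) ∸ 1
      e = q ^ suc d ∸ 1
      X = qFalling w b
      Y = qFalling (m ∸ suc b) a
      Z = qFalling (m ∸ suc b) d
      U = g₁-cleared b a m

    m∸[1+a]≡w : m ∸ suc a ≡ w
    m∸[1+a]≡w = m+n∸m≡n (suc a) w

    m∸b≡[1+w]+[1+d] : m ∸ b ≡ suc w + suc d
    m∸b≡[1+w]+[1+d] = m≡n+o⇒m∸n≡o {n = b} (regroup b d w)
      where
      regroup : ∀ b d w → suc (b + suc d) + w ≡ b + (suc w + suc d)
      regroup = solve-∀

    m∸[1+b]≡[1+d]+w : m ∸ suc b ≡ suc d + w
    m∸[1+b]≡[1+d]+w = m≡n+o⇒m∸n≡o {n = suc b} (regroup b d w)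
      where
      regroup : ∀ b d w → suc (b + suc d) + w ≡ suc b + (suc d + w)
      regroup = solve-∀

    b≤w : b ≤ w
    b≤w = ≤-trans (n≤1+n b) (m≤m+n (suc b) g)

    b+[1+a]≤m : b + suc a ≤ m
    b+[1+a]≤m = subst (_≤ m) (+-comm (suc a) b) (+-monoʳ-≤ (suc a) b≤w)

    a+[1+b]≤m : a + suc b ≤ m
    a+[1+b]≤m = +-mono-≤ (n≤1+n a) (m≤m+n (suc b) g)

    qFalling-m-a : qFalling m a ≡ qFalling m b * (F * Z)
    qFalling-m-a = begin
      qFalling m (b + suc d)                       ≡⟨ qFalling-+ m b (suc d) ⟩
      qFalling m b * qFalling (m ∸ b) (suc d)      ≡⟨ cong (qFalling m b *_) (qFalling-suc (m ∸ b) d) ⟩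
      qFalling m b * (F * qFalling (m ∸ b ∸ 1) d)  ≡⟨ cong (λ x → qFalling m b * (F * qFalling x d)) m∸b∸1≡m∸[1+b] ⟩
      qFalling m b * (F * Z)                       ∎
      where
      open ≡-Reasoning
      m∸b∸1≡m∸[1+b] : m ∸ b ∸ 1 ≡ m ∸ suc b
      m∸b∸1≡m∸[1+b] = trans (∸-+-assoc m b 1) (cong (m ∸_) (+-comm b 1))

    Y≡Z*[q^[1+w]∸1]*X : Y ≡ Z * (q ^ suc w ∸ 1) * X
    Y≡Z*[q^[1+w]∸1]*X = begin
      qFalling (m ∸ suc b) (b + suc d)                                 ≡⟨ cong (qFalling (m ∸ suc b)) (+-comm b (suc d)) ⟩
      qFalling (m ∸ suc b) (suc d + b)                                 ≡⟨ qFalling-+ (m ∸ suc b) (suc d) b ⟩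
      Z * (q ^ (m ∸ suc b ∸ d) ∸ 1) * qFalling (m ∸ suc b ∸ suc d) b  ≡⟨ cong₂ (λ i j → Z * (q ^ i ∸ 1) * qFalling j b)
                                                                            m∸[1+b]∸d m∸[1+b]∸[1+d] ⟩
      Z * (q ^ suc w ∸ 1) * X                                          ∎
      where
      open ≡-Reasoning
      m∸[1+b]∸d : m ∸ suc b ∸ d ≡ suc w
      m∸[1+b]∸d = trans (cong (_∸ d) m∸[1+b]≡[1+d]+w) (m≡n+o⇒m∸n≡o (sym (+-suc d w)))
      m∸[1+b]∸[1+d] : m ∸ suc b ∸ suc d ≡ w
      m∸[1+b]∸[1+d] = trans (cong (_∸ suc d) m∸[1+b]≡[1+d]+w) (m+n∸m≡n (suc d) w)

    Q₂≡Q₁*q^[1+d] : Q₂ ≡ Q₁ * q ^ suc d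
    Q₂≡Q₁*q^[1+d] = trans (cong (q ^_) (exponents b d)) (^-distribˡ-+-* q (suc a * b) (suc d))
      where
      exponents : ∀ b d → suc b * (b + suc d) ≡ suc (b + suc d) * b + suc d
      exponents = solve-∀

    q^[1+d]*[q^[1+w]∸1]+e≡F : q ^ suc d * (q ^ suc w ∸ 1) + e ≡ F
    q^[1+d]*[q^[1+w]∸1]+e≡F =
      trans (q^*[q^∸1]+q^∸1 (suc w) (suc d)) (cong (λ i → q ^ i ∸ 1) (sym m∸b≡[1+w]+[1+d]))

    U+Q₁*X≡qFalling-m-b : U + Q₁ * X ≡ qFalling m b
    U+Q₁*X≡qFalling-m-b = subst (λ i → U + Q₁ * qFalling i b ≡ qFalling m b) m∸[1+a]≡w
      (m∸n+n≡m (qFalling-shift∸ (suc a) b b+[1+a]≤m))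

    qFalling-m-a≡Q₂*Y+ : qFalling m a ≡ Q₂ * Y + Z * (F * U + Q₁ * e * X)
    qFalling-m-a≡Q₂*Y+ = begin
      qFalling m a                                                   ≡⟨ qFalling-m-a ⟩
      qFalling m b * (F * Z)                                         ≡⟨ cong (_* (F * Z)) U+Q₁*X≡qFalling-m-b ⟨
      (U + Q₁ * X) * (F * Z)                                         ≡⟨ expand U Q₁ X F Z ⟩
      Q₁ * X * Z * F + Z * (F * U)                                   ≡⟨ cong (λ f → Q₁ * X * Z * f + Z * (F * U))
                                                                          q^[1+d]*[q^[1+w]∸1]+e≡F ⟨
      Q₁ * X * Z * (q ^ suc d * (q ^ suc w ∸ 1) + e) + Z * (F * U)   ≡⟨ regroup Q₁ (q ^ suc d) X Z (q ^ suc w ∸ 1) e F U ⟩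
      Q₁ * q ^ suc d * (Z * (q ^ suc w ∸ 1) * X) + Z * (F * U + Q₁ * e * X)
                                                                     ≡⟨ cong₂ (λ c y → c * y + Z * (F * U + Q₁ * e * X))
                                                                          Q₂≡Q₁*q^[1+d] Y≡Z*[q^[1+w]∸1]*X ⟨
      Q₂ * Y + Z * (F * U + Q₁ * e * X)                              ∎
      where
      open ≡-Reasoning
      expand : ∀ u c x f z → (u + c * x) * (f * z) ≡ c * x * z * f + z * (f * u)
      expand = solve-∀
      regroup : ∀ c p x z h e f u → c * x * z * (p * h + e) + z * (f * u) ≡ c * p * (z * h * x) + z * (f * u + c * e * x)
      regroup = solve-∀

    g₁-cleared-a-b≡ : g₁-cleared a b m ≡ Z * (F * U + Q₁ * e * X)
    g₁-cleared-a-b≡ = trans (cong (_∸ Q₂ * Y) qFalling-m-a≡Q₂*Y+) (m+n∸m≡n (Q₂ * Y) _)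

    module _ {t : ℕ} (1≤b : 1 ≤ b) (t≤g : t ≤ g) where
      instance
        b-nonZero : NonZero b
        b-nonZero = >-nonZero 1≤b

      q^[1+a]*[q^t∸1]<Q₁*q^[g*b] : q ^ suc a * qFalling t 1 < Q₁ * q ^ (g * b)
      q^[1+a]*[q^t∸1]<Q₁*q^[g*b] = begin-strict
        q ^ suc a * qFalling t 1  ≡⟨ cong (q ^ suc a *_) (*-identityˡ (q ^ t ∸ 1)) ⟩
        q ^ suc a * (q ^ t ∸ 1)   <⟨ *-monoʳ-< (q ^ suc a) {{m^n≢0 q (suc a)}} (q^∸1<q^ t) ⟩
        q ^ suc a * q ^ t         ≡⟨ ^-distribˡ-+-* q (suc a) t ⟨
        q ^ (suc a + t)           ≤⟨ ^-monoʳ-≤ q (+-mono-≤ (m≤m*n (suc a) b) (≤-trans t≤g (m≤m*n g b))) ⟩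
        q ^ (suc a * b + g * b)   ≡⟨ ^-distribˡ-+-* q (suc a * b) (g * b) ⟩
        Q₁ * q ^ (g * b)          ∎
        where open ≤-Reasoning

      qFalling-a-a≡ : qFalling a a ≡ qFalling a d * (qFalling (suc b) b * qFalling 1 1)
      qFalling-a-a≡ = begin
        qFalling a a                                        ≡⟨ cong (λ x → qFalling x x) a≡d+[1+b] ⟩
        qFalling (d + suc b) (d + suc b)                    ≡⟨ qFalling-diag-+ d (suc b) ⟩
        qFalling (d + suc b) d * qFalling (suc b) (suc b)   ≡⟨ cong₂ _*_ (cong (λ x → qFalling x d) (sym a≡d+[1+b]))
                                                                 (qFalling-diag-suc b) ⟩
        qFalling a d * (qFalling (suc b) b * qFalling 1 1)  ∎
        where
        open ≡-Reasoning
        a≡d+[1+b] : a ≡ d + suc b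
        a≡d+[1+b] = trans (+-suc b d) (trans (cong suc (+-comm b d)) (sym (+-suc d b)))

      K<cross-term : q ^ suc a * qFalling t 1 * qFalling a a < Z * (Q₁ * e * X) * qFalling 1 1
      K<cross-term = begin-strict
        q ^ suc a * qFalling t 1 * qFalling a a       ≡⟨ cong (q ^ suc a * qFalling t 1 *_) qFalling-a-a≡ ⟩
        q ^ suc a * qFalling t 1 * W                  <⟨ *-monoˡ-< W {{>-nonZero W-pos}} q^[1+a]*[q^t∸1]<Q₁*q^[g*b] ⟩
        Q₁ * q ^ (g * b) * W                          ≡⟨ regroup Q₁ (q ^ (g * b)) (qFalling a d) (qFalling (suc b) b) f₁ ⟩
        qFalling a d * (Q₁ * 1 * (q ^ (g * b) * qFalling (suc b) b)) * f₁
          ≤⟨ *-monoˡ-≤ f₁ (*-mono-≤ (qFalling-mono d a≤m∸[1+b])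
               (*-mono-≤ (*-monoʳ-≤ Q₁ (q^∸1-pos {suc d} z<s)) (qFalling-shift (suc b) g b (n≤1+n b)))) ⟩
        Z * (Q₁ * e * X) * f₁                         ∎
        where
        open ≤-Reasoning
        f₁ W : ℕ
        f₁ = qFalling 1 1
        W = qFalling a d * (qFalling (suc b) b * f₁)
        W-pos : 0 < W
        W-pos = *-mono-≤ (qFalling-pos (≤-trans (n≤1+n d) (m≤n+m (suc d) b)))
          (*-mono-≤ (qFalling-pos (n≤1+n b)) (qFalling-pos {1} {1} ≤-refl))
        a≤m∸[1+b] : a ≤ m ∸ suc b
        a≤m∸[1+b] = subst (a ≤_) (sym m∸[1+b]≡[1+d]+w)
          (subst (_≤ suc d + w) (+-comm (suc d) b) (+-monoʳ-≤ (suc d) b≤w))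
        regroup : ∀ c h p r f → c * h * (p * (r * f)) ≡ p * (c * 1 * (h * r)) * f
        regroup = solve-∀

      g₁g₂-cleared-< : g₁-cleared b a m * g₂-cleared a m t < g₁-cleared a b m * g₂-cleared b m t
      g₁g₂-cleared-< = begin-strict
        U * (qFalling m a * f₁ + K)               ≡⟨ cong (λ p → U * (p * f₁ + K)) qFalling-m-a ⟩
        U * (Mb * (F * Z) * f₁ + K)               ≡⟨ cong (λ p → U * (p + K)) (*-assoc Mb (F * Z) f₁) ⟩
        U * (Mb * (F * Z * f₁) + K)               <⟨ u*[m*a+k]<[u*a+l]*m+r (F * Z * f₁) (V * R)
                                                       (m∸n≤m Mb (Q₁ * _)) Mb-pos K<cross-term ⟩
        (U * (F * Z * f₁) + Z * (Q₁ * e * X) * f₁) * Mb + V * R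
                                                  ≡⟨ regroup U F Z f₁ (Q₁ * e * X) Mb R ⟩
        V * (Mb * f₁ + R)                         ≡⟨ cong (_* (Mb * f₁ + R)) g₁-cleared-a-b≡ ⟨
        g₁-cleared a b m * g₂-cleared b m t       ∎
        where
        open ≤-Reasoning
        f₁ Mb K R V : ℕ
        f₁ = qFalling 1 1
        Mb = qFalling m b
        K = q ^ suc a * qFalling t 1 * qFalling a a
        R = q ^ suc b * qFalling t 1 * qFalling b b
        V = Z * (F * U + Q₁ * e * X)
        Mb-pos : 0 < Mb
        Mb-pos = qFalling-pos (≤-trans b≤w (m≤n+m w (suc a)))
        regroup : ∀ u f z c x mb r → (u * (f * z * c) + z * x * c) * mb + z * (f * u + x) * r ≡ z * (f * u + x) * (mb * c + r)
        regroup = solve-∀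

data Shape : ℕ → ℕ → ℕ → ℕ → Set where
  shape : ∀ b d g t → 1 ≤ b → t ≤ g → Shape (t + (suc (b + suc d) + (suc b + g))) (t + (b + suc d)) (t + b) t

shape-≡ : ∀ {n k₁ k₂} b d g t → 1 ≤ b → t ≤ g →
  n ≡ t + (suc (b + suc d) + (suc b + g)) → k₁ ≡ t + (b + suc d) → k₂ ≡ t + b → Shape n k₁ k₂ t
shape-≡ b d g t 1≤b t≤g refl refl refl = shape b d g t 1≤b t≤g

shape-of : ∀ {n k₁ k₂ t} → k₁ + k₂ + t + 3 ≤ n → t + 1 ≤ k₂ → k₂ < k₁ → Shape n k₁ k₂ t
shape-of {t = t} n-large k₂>t k₂<k₁ with m≤n⇒∃[o]m+o≡n k₂>t | m≤n⇒∃[o]m+o≡n k₂<k₁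
... | b′ , refl | d , refl with m≤n⇒∃[o]m+o≡n n-large
... | e , n≡ = shape-≡ (suc b′) d (t + (t + suc e)) t z<s (m≤m+n t _)
  (trans (sym n≡) (regroup-n t b′ d e)) (regroup-k₁ t b′ d) (regroup-k₂ t b′)
  where
  regroup-n : ∀ t b d e → suc (t + 1 + b + d) + (t + 1 + b) + t + 3 + e
                        ≡ t + (suc (suc b + suc d) + (suc (suc b) + (t + (t + suc e))))
  regroup-n = solve-∀
  regroup-k₁ : ∀ t b d → suc (t + 1 + b + d) ≡ t + (suc b + suc d)
  regroup-k₁ = solve-∀
  regroup-k₂ : ∀ t b → t + 1 + b ≡ t + suc b
  regroup-k₂ = solve-∀

primePower>1 : ∀ {q} → IsPrimePower q → 1 < q
primePower>1 (p , k , p-prime , refl) = ^-monoʳ-< p (nonTrivial⇒n>1 p {{prime⇒nonTrivial p-prime}}) (z<s {k})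

lemma5p6 : (q n k₁ k₂ t : ℕ) → IsPrimePower q →
    1 ≤ n → 1 ≤ k₁ → 1 ≤ k₂ → 1 ≤ t →
    k₁ + k₂ + t + 3 ≤ n → k₂ ≤ k₁ → t + 1 ≤ k₂ → k₂ < k₁ →
    (g₁ q k₂ k₁ n t *ℚ g₂ q k₁ n t) <ℚ (g₁ q k₁ k₂ n t *ℚ g₂ q k₂ n t)
lemma5p6 q n k₁ k₂ t q-primePower _ _ _ _ n-large _ k₂>t k₂<k₁ with shape-of n-large k₂>t k₂<k₁
... | shape b d g t 1≤b t≤g =
  cleared-<⇒< t (b + suc d) b (suc (b + suc d) + (suc b + g)) (b+[1+a]≤m b d g) (a+[1+b]≤m b d g)
    (g₁g₂-cleared-< b d g 1≤b t≤g)
  where open FixedBase q (primePower>1 q-primePower)
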